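{- Let $\mathcal{C}$ be any set of 3-literal clauses on a variable set $X$, in which each clause involves three distinct variables, and let $\mathcal{F}$ be its M-NAE version. Then the representative graph $G^\triangleleft(\mathcal{F})$ is an oriented graph, meaning it has no loops and no pair of opposite arcs. Moreover, every directed cycle of $G^\triangleleft(\mathcal{F})$ is strongly 3-covered.
   Context: The clauses. Let $X=\{x_1,\dots,x_n\}$ and let $\mathcal{C}=\{C_1,\dots,C_m\}$. Each clause is written $C_r=(l_i\vee l_j\vee l_k)$ with $i<j<k$ and $l_u\in\{x_u,\overline{x_u}\}$. The variables. Let $U_2=\{y_1,\dots,y_n,w_1,\dots,w_m,z\}$. The variable set is $U_3=\{z\}\cup\bigcup_{g\in U_2\setminus\{z\}}\{\alpha_g,\beta_g,a_g,b_g,c_g\}$. The M-NAE version $\mathcal{F}$ of $\mathcal{C}$ is the following set of clauses over $U_3$, all literals in positive form, with literal order as written: - for each $C_r=(l_i\vee l_j\vee l_k)$, the clauses $F_r=(\gamma_i\vee\gamma_j\vee\alpha_{w_r})$ and $F'_r=(\beta_{w_r}\vee\gamma_k\vee z)$, where $\gamma_u=\alpha_{y_u}$ if $l_u=x_u$ and $\gamma_u=\beta_{y_u}$ if $l_u=\overline{x_u}$; - for each $g\in U_2\setminus\{z\}$, the four clauses $(\alpha_g\vee\beta_g\vee a_g)$, $(\alpha_g\vee\beta_g\vee b_g)$, $(\alpha_g\vee\beta_g\vee c_g)$ and $(a_g\vee b_g\vee c_g)$. The representative graph $G^\triangleleft(\mathcal{F})$ has vertex set $U_3$. It contains an arc $uv$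 iff some clause $(p\vee q\vee r)$ of $\mathcal{F}$, in the order written, has $(u,v)\in\{(p,q),(q,r),(r,p)\}$. There are no multiple arcs. A cycle is strongly 3-covered if it contains the three variables of some single clause of $\mathcal{F}$. -}

module Defs where

open import Data.Nat using (ℕ)
open import Data.Fin using (Fin; _<_)
open import Data.Bool using (Bool; true; false)
open import Data.List using (List; []; _∷_; _++_; map; concatMap; allFin; _∷ʳ_)
open import Data.List.Membership.Propositional using (_∈_)
open import Data.List.Relation.Unary.Any using (Any)
open import Data.List.Relation.Unary.Unique.Propositional using (Unique)
open import Data.List.Relation.Unary.Linked using (Linked)
open import Data.Product using (Σ; _×_; ∃; ∃-syntax; _,_)
open import Data.Sum using (_⊎_)
open import Relation.Binary.PropositionalEquality using (_≡_)
open import Relation.Nullary using (¬_)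

-- A 3-literal clause (l_i ∨ l_j ∨ l_k) on variables x_0..x_{n-1} (= Fin n),
-- with i < j < k (hence three distinct variables).  The sign bit is
-- true when the literal is the positive literal x_u, false for ¬x_u.
record Clause (n : ℕ) : Set where
  constructor clause
  field
    i j k   : Fin n
    i<j     : i < j
    j<k     : j < k
    si sj sk : Bool

-- U₂ \ {z} : the variables y_u (u ∈ X) and w_r (r a clause index)
data G (n m : ℕ) : Set where
  y : Fin n → G n m
  w : Fin m → G n m

data V (n m : ℕ) : Set where
  z : V n m
  α β a b c : G n m → V n m

-- an (ordered) clause of F, all literals positive
record NClause (n m : ℕ) : Set where
  constructor ⟨_,_,_⟩
  field
    p q r : V n m

module _ {n m : ℕ} (C : Fin m → Clause n) where

  γ : Fin n → Bool → V n m
  γ u true  = α (y u)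
  γ u false = β (y u)

  clauseF : Fin m → List (NClause n m)
  clauseF t = ⟨ γ i si , γ j sj , α (w t) ⟩ ∷ ⟨ β (w t) , γ k sk , z ⟩ ∷ []
    where open Clause (C t)

  gadget : G n m → List (NClause n m)
  gadget g = ⟨ α g , β g , a g ⟩ ∷ ⟨ α g , β g , b g ⟩ ∷ ⟨ α g , β g , c g ⟩
             ∷ ⟨ a g , b g , c g ⟩ ∷ []

  allG : List (G n m)
  allG = map y (allFin n) ++ map w (allFin m)

  MNAE : List (NClause n m)
  MNAE = concatMap clauseF (allFin m) ++ concatMap gadget allG

  ArcOf : NClause n m → V n m → V n m → Set
  ArcOf ⟨ p , q , r ⟩ u v = (u ≡ p × v ≡ q) ⊎ (u ≡ q × v ≡ r) ⊎ (u ≡ r × v ≡ p)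

  Arc : V n m → V n m → Set
  Arc u v = Any (λ cl → ArcOf cl u v) MNAE

  Oriented : Set
  Oriented = (∀ u → ¬ Arc u u) × (∀ u v → Arc u v → ¬ Arc v u)

  DirectedCycle : V n m → List (V n m) → Set
  DirectedCycle v vs = Unique (v ∷ vs) × Linked Arc ((v ∷ vs) ∷ʳ v)

  Strongly3Covered : List (V n m) → Set
  Strongly3Covered cyc =
    ∃[ cl ] (cl ∈ MNAE × NClause.p cl ∈ cyc × NClause.q cl ∈ cyc × NClause.r cl ∈ cyc)

-- Give each vertex a potential φ : layer u of X occupies the block
-- 4u .. 4u+3 (α_{y_u} ↦ 4u, β_{y_u} ↦ 4u+1, and for C_r = (l_i ∨ l_j ∨ l_k)
-- α_{w_r} ↦ 4j+2, β_{w_r} ↦ 4j+3).  Since i < j < k, the arcs γ_i→γ_j,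
-- γ_j→α_{w_r}, β_{w_r}→γ_k and α_g→β_g raise φ.  Every other arc is
-- "local": it touches z, a gadget corner a_g/b_g/c_g, or is α_{w_r}→γ_i,
-- and the in/out-neighbourhoods of these vertices are so small that a closed
-- walk through one of them must contain all three variables of a clause.
-- A closed walk cannot raise φ all the way round, so it uses a local arc and
-- is strongly 3-covered.
--
-- Orientation then follows cheaply: no clause repeats a variable, so there
-- are no loops; and a 2-cycle u→v→u would be a closed walk covering the three
-- (pairwise distinct) variables of a clause with only two vertices.
module Submission where

open import Defs
open import Data.Nat using (ℕ; _+_; _*_; _≤_; _<_; s≤s)
open import Data.Nat.Properties
  using (≤-refl; n≤1+n; m≤n+m; *-suc; *-monoʳ-≤; <-irrefl; <-trans; module ≤-Reasoning)
open import Data.Fin using (Fin; toℕ)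
import Data.Fin.Properties as Fin
open import Data.Bool using (true; false)
open import Data.Unit using (⊤; tt)
open import Data.Empty using (⊥; ⊥-elim)
open import Data.List using (List; []; _∷_; map; concatMap; allFin; _∷ʳ_)
open import Data.List.Membership.Propositional using (_∈_; lose; find)
open import Data.List.Membership.Propositional.Properties
  using (∈-++⁺ˡ; ∈-++⁺ʳ; ∈-++⁻; ∈-map⁺; ∈-allFin; ∈-concatMap⁺; ∈-concatMap⁻)
open import Data.List.Relation.Unary.Any using (here; there; satisfied)
open import Data.List.Relation.Unary.All as All using (All; []; _∷_)
open import Data.List.Relation.Unary.Linked using (Linked; [-]; _∷_)
open import Data.Product using (_×_; ∃-syntax; _,_; proj₂)
open import Data.Sum using (_⊎_; inj₁; inj₂)
open import Relation.Binary.PropositionalEquality using (_≡_; _≢_; refl; sym; trans; subst)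
open import Relation.Nullary using (¬_)

∈-closing : ∀ {A : Set} {v : A} {vs x} → x ∈ (v ∷ vs) ∷ʳ v → x ∈ v ∷ vs
∈-closing {v = v} {vs} x∈ with ∈-++⁻ (v ∷ vs) x∈
... | inj₁ x∈′ = x∈′
... | inj₂ (here refl) = here refl

module _ {A : Set} {R : A → A → Set} where

  ClosedWalk : A → List A → Set
  ClosedWalk v vs = Linked R ((v ∷ vs) ∷ʳ v)

  successor : ∀ {t x} xs → Linked R (xs ∷ʳ t) → x ∈ xs → ∃[ s ] (s ∈ xs ∷ʳ t × R x s)
  successor (_ ∷ [])     (arc ∷ [-]) (here refl) = _ , there (here refl) , arc
  successor (_ ∷ _ ∷ _)  (arc ∷ _)   (here refl) = _ , there (here refl) , arc
  successor (_ ∷ x′ ∷ xs) (_ ∷ walk) (there x∈) with successor (x′ ∷ xs) walk x∈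
  ... | s , s∈ , arc = s , there s∈ , arc

  predecessor : ∀ {h x ys} → Linked R (h ∷ ys) → x ∈ ys → ∃[ p ] (p ∈ h ∷ ys × R p x)
  predecessor (arc ∷ _)    (here refl) = _ , here refl , arc
  predecessor (_ ∷ walk) (there x∈) with predecessor walk x∈
  ... | p , p∈ , arc = p , there p∈ , arc

  cycle-successor : ∀ {v vs x} → ClosedWalk v vs → x ∈ v ∷ vs → ∃[ s ] (s ∈ v ∷ vs × R x s)
  cycle-successor {v} {vs} walk x∈ with successor (v ∷ vs) walk x∈
  ... | s , s∈ , arc = s , ∈-closing s∈ , arc

  cycle-predecessor : ∀ {v vs x} → ClosedWalk v vs → x ∈ v ∷ vs → ∃[ p ] (p ∈ v ∷ vs × R p x)
  cycle-predecessor {v} {vs} walk x∈ with predecessor walk (rotate x∈)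
    where
    rotate : ∀ {x} → x ∈ v ∷ vs → x ∈ vs ∷ʳ v
    rotate (here refl) = ∈-++⁺ʳ vs (here refl)
    rotate (there x∈′) = ∈-++⁺ˡ x∈′
  ... | p , p∈ , arc = p , ∈-closing p∈ , arc

  walk-ascends : {P : A → Set} {Q : Set} (φ : A → ℕ)
    → (∀ {x y} → P x → P y → R x y → Q ⊎ φ x < φ y)
    → ∀ {x t} xs → Linked R (x ∷ (xs ∷ʳ t)) → P x → All P xs → P t → Q ⊎ φ x < φ t
  walk-ascends φ step []       (arc ∷ [-])  Px []          Pt = step Px Pt arc
  walk-ascends φ step (_ ∷ xs) (arc ∷ walk) Px (Px′ ∷ Pxs) Pt
    with step Px Px′ arc | walk-ascends φ step xs walk Px′ Pxs Pt
  ... | inj₁ q  | _      = inj₁ q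
  ... | inj₂ _  | inj₁ q = inj₁ q
  ... | inj₂ up | inj₂ up′ = inj₂ (<-trans up up′)

  -- hence a closed walk on which no arc yields Q would have φ v < φ v
  closed-walk-escapes : ∀ {Q : Set} {v vs} (φ : A → ℕ)
    → (∀ {x y} → x ∈ v ∷ vs → y ∈ v ∷ vs → R x y → Q ⊎ φ x < φ y)
    → ClosedWalk v vs → Q
  closed-walk-escapes {vs = vs} φ step walk
    with walk-ascends φ step vs walk (here refl) (All.tabulate there) (here refl)
  ... | inj₁ q      = q
  ... | inj₂ φv<φv = ⊥-elim (<-irrefl refl φv<φv)

pigeonhole : ∀ {A : Set} {u v p q r : A} → p ∈ u ∷ v ∷ [] → q ∈ u ∷ v ∷ [] → r ∈ u ∷ v ∷ []
  → p ≡ q ⊎ q ≡ r ⊎ r ≡ p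
pigeonhole (here refl)         (here refl)         _                   = inj₁ refl
pigeonhole (there (here refl)) (there (here refl)) _                   = inj₁ refl
pigeonhole (here refl)         (there (here refl)) (here refl)         = inj₂ (inj₂ refl)
pigeonhole (here refl)         (there (here refl)) (there (here refl)) = inj₂ (inj₁ refl)
pigeonhole (there (here refl)) (here refl)         (here refl)         = inj₂ (inj₁ refl)
pigeonhole (there (here refl)) (here refl)         (there (here refl)) = inj₂ (inj₂ refl)

block-below : ∀ {p q} → p < q → 3 + 4 * p < 4 * q
block-below {p} {q} p<q = subst (_≤ 4 * q) (*-suc 4 p) (*-monoʳ-≤ 4 p<q)

data Corner : Set where
  first second third : Corner

corner : ∀ {n m} → Corner → G n m → V n m
corner first  = a
corner second = b
corner third  = c

next prev : Corner → Corner
next first  = second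
next second = third
next third  = first
prev first  = third
prev second = first
prev third  = second

all-corners-next : ∀ {n m} {P : V n m → Set} {g} k
  → P (corner k g) → P (corner (next k) g) → P (corner (next (next k)) g) → P (a g) × P (b g) × P (c g)
all-corners-next first  Pa Pb Pc = Pa , Pb , Pc
all-corners-next second Pb Pc Pa = Pa , Pb , Pc
all-corners-next third  Pc Pa Pb = Pa , Pb , Pc

all-corners-prev : ∀ {n m} {P : V n m → Set} {g} k
  → P (corner k g) → P (corner (prev k) g) → P (corner (prev (prev k)) g) → P (a g) × P (b g) × P (c g)
all-corners-prev first  Pa Pc Pb = Pa , Pb , Pc
all-corners-prev second Pb Pa Pc = Pa , Pb , Pc
all-corners-prev third  Pc Pb Pa = Pa , Pb , Pc

-- the vertices α_{y_u}, β_{y_u}: the only possible values of a literal γ_u,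
-- used to separate literals from every other vertex
IsLiteral : ∀ {n m} → V n m → Set
IsLiteral (α (y _)) = ⊤
IsLiteral (β (y _)) = ⊤
IsLiteral _         = ⊥

corner-not-literal : ∀ {n m} k {g : G n m} → ¬ IsLiteral (corner k g)
corner-not-literal first  ()
corner-not-literal second ()
corner-not-literal third  ()

module _ {n m : ℕ} (C : Fin m → Clause n) where

  γi γj γk : Fin m → V n m
  γi r = γ C (Clause.i (C r)) (Clause.si (C r))
  γj r = γ C (Clause.j (C r)) (Clause.sj (C r))
  γk r = γ C (Clause.k (C r)) (Clause.sk (C r))

  literal : ∀ {x u s} → x ≡ γ C u s → IsLiteral x
  literal {s = true}  refl = tt
  literal {s = false} refl = tt

  γ-injective : ∀ {u u′ s s′} → γ C u s ≡ γ C u′ s′ → u ≡ u′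
  γ-injective {s = true}  {s′ = true}  refl = refl
  γ-injective {s = false} {s′ = false} refl = refl

  γi≢γj : ∀ r → γi r ≢ γj r
  γi≢γj r eq = Fin.<-irrefl (γ-injective eq) (Clause.i<j (C r))

  data MNAEClause : NClause n m → Set where
    F        : ∀ r → MNAEClause ⟨ γi r , γj r , α (w r) ⟩
    F′       : ∀ r → MNAEClause ⟨ β (w r) , γk r , z ⟩
    corner-F : ∀ k g → MNAEClause ⟨ α g , β g , corner k g ⟩
    triangle : ∀ g → MNAEClause ⟨ a g , b g , c g ⟩

  mnae-view : ∀ {cl} → cl ∈ MNAE C → MNAEClause cl
  mnae-view cl∈ with ∈-++⁻ (concatMap (clauseF C) (allFin m)) cl∈
  ... | inj₁ cl∈F with satisfied (∈-concatMap⁻ (clauseF C) {allFin m} cl∈F)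
  ...   | r , here refl         = F r
  ...   | r , there (here refl) = F′ r
  mnae-view cl∈ | inj₂ cl∈G with satisfied (∈-concatMap⁻ (gadget C) {allG C} cl∈G)
  ...   | g , here refl                         = corner-F first g
  ...   | g , there (here refl)                 = corner-F second g
  ...   | g , there (there (here refl))         = corner-F third g
  ...   | g , there (there (there (here refl))) = triangle g

  gadget-member : ∀ g {cl} → cl ∈ gadget C g → cl ∈ MNAE C
  gadget-member g cl∈ =
    ∈-++⁺ʳ (concatMap (clauseF C) (allFin m)) (∈-concatMap⁺ (gadget C) (lose (g∈allG g) cl∈))
    where
    g∈allG : ∀ g → g ∈ allG C
    g∈allG (y u) = ∈-++⁺ˡ (∈-map⁺ y (∈-allFin u))
    g∈allG (w r) = ∈-++⁺ʳ (map y (allFin n)) (∈-map⁺ w (∈-allFin r))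

  mnae-member : ∀ {cl} → MNAEClause cl → cl ∈ MNAE C
  mnae-member (F r)  = ∈-++⁺ˡ (∈-concatMap⁺ (clauseF C) (lose (∈-allFin r) (here refl)))
  mnae-member (F′ r) = ∈-++⁺ˡ (∈-concatMap⁺ (clauseF C) (lose (∈-allFin r) (there (here refl))))
  mnae-member (corner-F first g)  = gadget-member g (here refl)
  mnae-member (corner-F second g) = gadget-member g (there (here refl))
  mnae-member (corner-F third g)  = gadget-member g (there (there (here refl)))
  mnae-member (triangle g)        = gadget-member g (there (there (there (here refl))))

  -- Arcs with a literal endpoint carry that endpoint as an equation: γ is not
  -- a constructor, and indices must stay matchable against concrete vertices.
  data ArcView : V n m → V n m → Set where
    γi⇒γj : ∀ r {u v} → u ≡ γi r → v ≡ γj r → ArcView u v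
    γj⇒αw : ∀ r {u} → u ≡ γj r → ArcView u (α (w r))
    αw⇒γi : ∀ r {v} → v ≡ γi r → ArcView (α (w r)) v
    βw⇒γk : ∀ r {v} → v ≡ γk r → ArcView (β (w r)) v
    γk⇒z  : ∀ r {u} → u ≡ γk r → ArcView u z
    z⇒βw  : ∀ r → ArcView z (β (w r))
    α⇒β   : ∀ g → ArcView (α g) (β g)
    β⇒a   : ∀ g → ArcView (β g) (a g)
    β⇒b   : ∀ g → ArcView (β g) (b g)
    β⇒c   : ∀ g → ArcView (β g) (c g)
    a⇒α   : ∀ g → ArcView (a g) (α g)
    b⇒α   : ∀ g → ArcView (b g) (α g)
    c⇒α   : ∀ g → ArcView (c g) (α g)
    a⇒b   : ∀ g → ArcView (a g) (b g)
    b⇒c   : ∀ g → ArcView (b g) (c g)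
    c⇒a   : ∀ g → ArcView (c g) (a g)

  clause-arc-view : ∀ {cl u v} → MNAEClause cl → ArcOf C cl u v → ArcView u v
  clause-arc-view (F r)  (inj₁ (refl , refl))        = γi⇒γj r refl refl
  clause-arc-view (F r)  (inj₂ (inj₁ (refl , refl))) = γj⇒αw r refl
  clause-arc-view (F r)  (inj₂ (inj₂ (refl , refl))) = αw⇒γi r refl
  clause-arc-view (F′ r) (inj₁ (refl , refl))        = βw⇒γk r refl
  clause-arc-view (F′ r) (inj₂ (inj₁ (refl , refl))) = γk⇒z r refl
  clause-arc-view (F′ r) (inj₂ (inj₂ (refl , refl))) = z⇒βw r
  clause-arc-view (corner-F _ g)      (inj₁ (refl , refl))        = α⇒β g
  clause-arc-view (corner-F first g)  (inj₂ (inj₁ (refl , refl))) = β⇒a g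
  clause-arc-view (corner-F second g) (inj₂ (inj₁ (refl , refl))) = β⇒b g
  clause-arc-view (corner-F third g)  (inj₂ (inj₁ (refl , refl))) = β⇒c g
  clause-arc-view (corner-F first g)  (inj₂ (inj₂ (refl , refl))) = a⇒α g
  clause-arc-view (corner-F second g) (inj₂ (inj₂ (refl , refl))) = b⇒α g
  clause-arc-view (corner-F third g)  (inj₂ (inj₂ (refl , refl))) = c⇒α g
  clause-arc-view (triangle g) (inj₁ (refl , refl))        = a⇒b g
  clause-arc-view (triangle g) (inj₂ (inj₁ (refl , refl))) = b⇒c g
  clause-arc-view (triangle g) (inj₂ (inj₂ (refl , refl))) = c⇒a g

  arc-view : ∀ {u v} → Arc C u v → ArcView u v
  arc-view arc with find arc
  ... | cl , cl∈ , arcOf = clause-arc-view (mnae-view cl∈) arcOf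

  z-out : ∀ {t} → ArcView z t → ∃[ r ] t ≡ β (w r)
  z-out (γi⇒γj _ e _) = ⊥-elim (literal e)
  z-out (γj⇒αw _ e)   = ⊥-elim (literal e)
  z-out (γk⇒z _ e)    = ⊥-elim (literal e)
  z-out (z⇒βw r)      = r , refl

  βw-out : ∀ {r t} → ArcView (β (w r)) t → t ≡ γk r ⊎ ∃[ k ] t ≡ corner k (w r)
  βw-out (γi⇒γj _ e _) = ⊥-elim (literal e)
  βw-out (γj⇒αw _ e)   = ⊥-elim (literal e)
  βw-out (γk⇒z _ e)    = ⊥-elim (literal e)
  βw-out (βw⇒γk _ e)   = inj₁ e
  βw-out (β⇒a _)       = inj₂ (first , refl)
  βw-out (β⇒b _)       = inj₂ (second , refl)
  βw-out (β⇒c _)       = inj₂ (third , refl)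

  αw-in : ∀ {r s} → ArcView s (α (w r)) → s ≡ γj r ⊎ ∃[ k ] s ≡ corner k (w r)
  αw-in (γi⇒γj _ _ e) = ⊥-elim (literal e)
  αw-in (αw⇒γi _ e)   = ⊥-elim (literal e)
  αw-in (βw⇒γk _ e)   = ⊥-elim (literal e)
  αw-in (γj⇒αw _ e)   = inj₁ e
  αw-in (a⇒α _)       = inj₂ (first , refl)
  αw-in (b⇒α _)       = inj₂ (second , refl)
  αw-in (c⇒α _)       = inj₂ (third , refl)

  corner-out : ∀ k {g t} → ArcView (corner k g) t → t ≡ α g ⊎ t ≡ corner (next k) g
  corner-out first  (a⇒α _) = inj₁ refl
  corner-out first  (a⇒b _) = inj₂ refl
  corner-out second (b⇒α _) = inj₁ refl
  corner-out second (b⇒c _) = inj₂ refl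
  corner-out third  (c⇒α _) = inj₁ refl
  corner-out third  (c⇒a _) = inj₂ refl
  corner-out k (γi⇒γj _ e _) = ⊥-elim (corner-not-literal k (literal e))
  corner-out k (γj⇒αw _ e)   = ⊥-elim (corner-not-literal k (literal e))
  corner-out k (γk⇒z _ e)    = ⊥-elim (corner-not-literal k (literal e))

  corner-in : ∀ k {g s} → ArcView s (corner k g) → s ≡ β g ⊎ s ≡ corner (prev k) g
  corner-in first  (β⇒a _) = inj₁ refl
  corner-in first  (c⇒a _) = inj₂ refl
  corner-in second (β⇒b _) = inj₁ refl
  corner-in second (a⇒b _) = inj₂ refl
  corner-in third  (β⇒c _) = inj₁ refl
  corner-in third  (b⇒c _) = inj₂ refl
  corner-in k (γi⇒γj _ _ e) = ⊥-elim (corner-not-literal k (literal e))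
  corner-in k (αw⇒γi _ e)   = ⊥-elim (corner-not-literal k (literal e))
  corner-in k (βw⇒γk _ e)   = ⊥-elim (corner-not-literal k (literal e))

  -- The potential: variable u of X owns the block 4u .. 4u+3, and the clause
  -- vertices α_{w_r}, β_{w_r} sit on top of the block of its middle variable j;
  -- z and the gadget corners get an arbitrary value, as no ascending arc uses them.
  φ : V n m → ℕ
  φ z         = 0
  φ (α (y u)) = 4 * toℕ u
  φ (β (y u)) = 1 + 4 * toℕ u
  φ (α (w r)) = 2 + 4 * toℕ (Clause.j (C r))
  φ (β (w r)) = 3 + 4 * toℕ (Clause.j (C r))
  φ (a _)     = 0
  φ (b _)     = 0
  φ (c _)     = 0

  φ-γ-lower : ∀ u s → 4 * toℕ u ≤ φ (γ C u s)
  φ-γ-lower u true  = ≤-refl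
  φ-γ-lower u false = n≤1+n _

  φ-γ-upper : ∀ u s → φ (γ C u s) ≤ 1 + 4 * toℕ u
  φ-γ-upper u true  = n≤1+n _
  φ-γ-upper u false = ≤-refl

  ascends-γi⇒γj : ∀ r → φ (γi r) < φ (γj r)
  ascends-γi⇒γj r = begin-strict
    φ (γi r)                     ≤⟨ φ-γ-upper (Clause.i (C r)) (Clause.si (C r)) ⟩
    1 + 4 * toℕ (Clause.i (C r)) ≤⟨ m≤n+m _ 2 ⟩
    3 + 4 * toℕ (Clause.i (C r)) <⟨ block-below (Clause.i<j (C r)) ⟩
    4 * toℕ (Clause.j (C r))     ≤⟨ φ-γ-lower (Clause.j (C r)) (Clause.sj (C r)) ⟩
    φ (γj r)                     ∎
    where open ≤-Reasoning

  ascends-γj⇒αw : ∀ r → φ (γj r) < φ (α (w r))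
  ascends-γj⇒αw r = s≤s (φ-γ-upper (Clause.j (C r)) (Clause.sj (C r)))

  ascends-βw⇒γk : ∀ r → φ (β (w r)) < φ (γk r)
  ascends-βw⇒γk r = begin-strict
    3 + 4 * toℕ (Clause.j (C r)) <⟨ block-below (Clause.j<k (C r)) ⟩
    4 * toℕ (Clause.k (C r))     ≤⟨ φ-γ-lower (Clause.k (C r)) (Clause.sk (C r)) ⟩
    φ (γk r)                     ∎
    where open ≤-Reasoning

  ascends-α⇒β : ∀ g → φ (α g) < φ (β g)
  ascends-α⇒β (y u) = ≤-refl
  ascends-α⇒β (w r) = ≤-refl

  module CoveredWalk {v vs} (walk : ClosedWalk {R = Arc C} v vs) where

    On : V n m → Set
    On x = x ∈ v ∷ vs

    Covered : Set
    Covered = Strongly3Covered C (v ∷ vs)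

    covered-by : ∀ {p q r} → MNAEClause ⟨ p , q , r ⟩ → On p → On q → On r → Covered
    covered-by cl p∈ q∈ r∈ = _ , mnae-member cl , p∈ , q∈ , r∈

    successor-on : ∀ {x} → On x → ∃[ t ] (On t × ArcView x t)
    successor-on x∈ with cycle-successor walk x∈
    ... | t , t∈ , arc = t , t∈ , arc-view arc

    predecessor-on : ∀ {x} → On x → ∃[ s ] (On s × ArcView s x)
    predecessor-on x∈ with cycle-predecessor walk x∈
    ... | s , s∈ , arc = s , s∈ , arc-view arc

    corner-reaches-α : ∀ k {g} → On (corner k g) → On (α g) ⊎ On (a g) × On (b g) × On (c g)
    corner-reaches-α k x∈ with successor-on x∈
    ... | t , t∈ , arc with corner-out k arc
    ...   | inj₁ refl = inj₁ t∈
    ...   | inj₂ refl with successor-on t∈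
    ...     | t′ , t′∈ , arc′ with corner-out (next k) arc′
    ...       | inj₁ refl = inj₁ t′∈
    ...       | inj₂ refl = inj₂ (all-corners-next {P = On} k x∈ t∈ t′∈)

    corner-reached-from-β : ∀ k {g} → On (corner k g) → On (β g) ⊎ On (a g) × On (b g) × On (c g)
    corner-reached-from-β k x∈ with predecessor-on x∈
    ... | s , s∈ , arc with corner-in k arc
    ...   | inj₁ refl = inj₁ s∈
    ...   | inj₂ refl with predecessor-on s∈
    ...     | s′ , s′∈ , arc′ with corner-in (prev k) arc′
    ...       | inj₁ refl = inj₁ s′∈
    ...       | inj₂ refl = inj₂ (all-corners-prev {P = On} k x∈ s∈ s′∈)

    corner-covered : ∀ k {g} → On (corner k g) → Covered
    corner-covered k {g} x∈ with corner-reaches-α k x∈ | corner-reached-from-β k x∈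
    ... | inj₂ (a∈ , b∈ , c∈) | _                   = covered-by (triangle g) a∈ b∈ c∈
    ... | inj₁ _              | inj₂ (a∈ , b∈ , c∈) = covered-by (triangle g) a∈ b∈ c∈
    ... | inj₁ α∈             | inj₁ β∈             = covered-by (corner-F k g) α∈ β∈ x∈

    z-covered : On z → Covered
    z-covered z∈ with successor-on z∈
    ... | t , t∈ , arc with z-out arc
    ...   | r , refl with successor-on t∈
    ...     | t′ , t′∈ , arc′ with βw-out arc′
    ...       | inj₁ refl       = covered-by (F′ r) t∈ t′∈ z∈
    ...       | inj₂ (k , refl) = corner-covered k t′∈

    αw-covered : ∀ r → On (α (w r)) → On (γi r) → Covered
    αw-covered r αw∈ γi∈ with predecessor-on αw∈
    ... | s , s∈ , arc with αw-in arc
    ...   | inj₁ refl       = covered-by (F r) γi∈ s∈ αw∈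
    ...   | inj₂ (k , refl) = corner-covered k s∈

    arc-covers-or-ascends : ∀ {x t} → On x → On t → ArcView x t → Covered ⊎ φ x < φ t
    arc-covers-or-ascends _  _  (γi⇒γj r refl refl) = inj₂ (ascends-γi⇒γj r)
    arc-covers-or-ascends _  _  (γj⇒αw r refl)      = inj₂ (ascends-γj⇒αw r)
    arc-covers-or-ascends x∈ t∈ (αw⇒γi r refl)      = inj₁ (αw-covered r x∈ t∈)
    arc-covers-or-ascends _  _  (βw⇒γk r refl)      = inj₂ (ascends-βw⇒γk r)
    arc-covers-or-ascends _  t∈ (γk⇒z _ _)          = inj₁ (z-covered t∈)
    arc-covers-or-ascends x∈ _  (z⇒βw _)            = inj₁ (z-covered x∈)
    arc-covers-or-ascends _  _  (α⇒β g)             = inj₂ (ascends-α⇒β g)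
    arc-covers-or-ascends _  t∈ (β⇒a _)             = inj₁ (corner-covered first t∈)
    arc-covers-or-ascends _  t∈ (β⇒b _)             = inj₁ (corner-covered second t∈)
    arc-covers-or-ascends _  t∈ (β⇒c _)             = inj₁ (corner-covered third t∈)
    arc-covers-or-ascends x∈ _  (a⇒α _)             = inj₁ (corner-covered first x∈)
    arc-covers-or-ascends x∈ _  (b⇒α _)             = inj₁ (corner-covered second x∈)
    arc-covers-or-ascends x∈ _  (c⇒α _)             = inj₁ (corner-covered third x∈)
    arc-covers-or-ascends x∈ _  (a⇒b _)             = inj₁ (corner-covered first x∈)
    arc-covers-or-ascends x∈ _  (b⇒c _)             = inj₁ (corner-covered second x∈)
    arc-covers-or-ascends x∈ _  (c⇒a _)             = inj₁ (corner-covered third x∈)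

    -- the potential cannot climb all the way round the walk
    covered : Covered
    covered = closed-walk-escapes φ (λ x∈ t∈ arc → arc-covers-or-ascends x∈ t∈ (arc-view arc)) walk

  closed-walk-covered : ∀ {v vs} → ClosedWalk {R = Arc C} v vs → Strongly3Covered C (v ∷ vs)
  closed-walk-covered walk = CoveredWalk.covered walk

  -- no clause of 𝓕 repeats a variable, so G◁(𝓕) has no loops
  loop-free : ∀ u → ¬ Arc C u u
  loop-free _ arc = no-loop (arc-view arc)
    where
    no-loop : ∀ {u} → ArcView u u → ⊥
    no-loop (γi⇒γj r e e′) = γi≢γj r (trans (sym e) e′)
    no-loop (γj⇒αw _ e)    = literal e
    no-loop (αw⇒γi _ e)    = literal e
    no-loop (βw⇒γk _ e)    = literal e
    no-loop (γk⇒z _ e)     = literal e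

  clause-arcs : ∀ {cl} → cl ∈ MNAE C → let open NClause cl in Arc C p q × Arc C q r × Arc C r p
  clause-arcs cl∈ = lose cl∈ (inj₁ (refl , refl))
                  , lose cl∈ (inj₂ (inj₁ (refl , refl)))
                  , lose cl∈ (inj₂ (inj₂ (refl , refl)))

  -- a 2-cycle u → v → u would cover a clause with two vertices; by the
  -- pigeonhole principle that clause would repeat a variable, i.e. carry a loop
  no-opposite-arcs : ∀ u v → Arc C u v → ¬ Arc C v u
  no-opposite-arcs u v uv vu with closed-walk-covered {vs = v ∷ []} (uv ∷ vu ∷ [-])
  ... | cl , cl∈ , p∈ , q∈ , r∈ with clause-arcs cl∈ | pigeonhole p∈ q∈ r∈
  ... | pq , _  , _  | inj₁ refl        = loop-free _ pq
  ... | _  , qr , _  | inj₂ (inj₁ refl) = loop-free _ qr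
  ... | _  , _  , rp | inj₂ (inj₂ refl) = loop-free _ rp

claim2 : (n m : ℕ) (C : Fin m → Clause n)
    → Oriented C × (∀ v vs → DirectedCycle C v vs → Strongly3Covered C (v ∷ vs))
claim2 n m C = (loop-free C , no-opposite-arcs C)
             , λ v vs cycle → closed-walk-covered C (proj₂ cycle)
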